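{- Let $n\geq 1$ and $t\geq 2$ be integers. There exists a perfect matching $F$ of $K_{2n}$ such that $\ell(F)=\left\{1^t,3^t,\ldots,\left(\frac{2n}{t}-1\right)^t\right\}$ (the list of $n$ elements in which each odd integer from $1$ to $\frac{2n}{t}-1$ appears exactly $t$ times) if and only if $n\equiv 0\pmod t$.
   Context: For a positive integer $v$, $K_v$ denotes the complete graph on the vertex set $\{0,1,\ldots,v-1\}$. The length of an edge $\{u,w\}$ of $K_v$ is $\ell(u,w)=\min(|u-w|,\,v-|u-w|)$. For a subgraph $\Gamma$ of $K_v$, $\ell(\Gamma)$ is the list (multiset) of lengths of all edges of $\Gamma$, counted with multiplicity. A perfect matching of $K_{2n}$ is a set of $n$ pairwise disjoint edges covering all vertices. The notation $\{z_1^{e_1},\ldots,z_k^{e_k}\}$ denotes the list containing $e_i$ copies of $z_i$. -}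

module Defs where

open import Data.Nat using (ℕ; zero; suc; _+_; _*_; _∸_; _/_; ∣_-_∣; _⊓_)
open import Data.Fin using (Fin; toℕ; _≟_)
open import Data.List using (List; []; _∷_; map; concatMap; replicate; upTo)
open import Data.Product using (_×_; _,_)
open import Relation.Nullary using (does)
open import Data.Bool using (if_then_else_)
open import Relation.Binary.PropositionalEquality using (_≡_)

-- An edge of K_v is represented by a pair of vertices (u , w) (unordered
-- meaning: the orientation is irrelevant for everything below).
Edge : ℕ → Set
Edge v = Fin v × Fin v

edgeLength : (v : ℕ) → Edge v → ℕ
edgeLength v (u , w) = ∣ toℕ u - toℕ w ∣ ⊓ (v ∸ ∣ toℕ u - toℕ w ∣)

ℓ : (v : ℕ) → List (Edge v) → List ℕ
ℓ v = map (edgeLength v)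

-- number of edge-endpoints of F equal to x (a loop {x,x} would count twice)
incidences : {v : ℕ} → Fin v → List (Edge v) → ℕ
incidences x [] = 0
incidences x ((u , w) ∷ F) =
  (if does (x ≟ u) then 1 else 0) + (if does (x ≟ w) then 1 else 0) + incidences x F

-- F is a perfect matching of K_v: a collection of edges (no loops) that are
-- pairwise disjoint and cover every vertex; equivalently every vertex is an
-- endpoint of exactly one edge of F (counting a loop twice).
IsPerfectMatching : (v : ℕ) → List (Edge v) → Set
IsPerfectMatching v F = (x : Fin v) → incidences x F ≡ 1

-- Writing x = 2i+1, the
-- condition x ≤ 2n/t - 1 (i.e. t(x+1) ≤ 2n) is equivalent to i < ⌊n/t⌋.
-- (t = 0 never occurs in the statement since t ≥ 2.)
oddList : ℕ → ℕ → List ℕ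
oddList n zero    = []
oddList n (suc t) = concatMap (λ i → replicate (suc t) (suc (2 * i))) (upTo (n / suc t))

-- Summing incidences over all vertices counts every edge twice, so a perfect
-- matching of K_{2n} has n edges; the list {1^t, 3^t, …} has t⌊n/t⌋ entries, hence t ∣ n.
-- Conversely, for n = qt cut the 2n vertices into t blocks of 2q consecutive
-- vertices and join q−1−i to q+i inside every block (i < q).  These nested chords
-- realise each odd length 2i+1 < 2q exactly once per block, and since
-- 2(2i+1) < 4q ≤ 2n the cyclic length of each chord is its plain distance.
module Submission where

open import Defs
open import Data.Bool using (Bool; if_then_else_)
open import Data.Fin
  using (Fin; zero; suc; toℕ; _≟_; _↑ˡ_; _↑ʳ_; opposite; combine; remQuot; splitAt; join)
open import Data.Fin.Properties
  using (toℕ<n; toℕ-↑ˡ; toℕ-↑ʳ; ↑ˡ-injective; ↑ʳ-injective;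
         opposite-prop; opposite-involutive;
         toℕ-combine; combine-injectiveˡ; combine-injectiveʳ; combine-remQuot; join-splitAt)
open import Data.List
  using (List; []; _∷_; _++_; map; concat; concatMap; replicate; upTo; applyUpTo; tabulate; length)
open import Data.List.Properties
  using (map-++; map-tabulate; tabulate-cong; map-upTo;
         length-map; length-++; length-replicate; length-upTo)
open import Data.List.Relation.Unary.All using (All; []; _∷_)
open import Data.List.Relation.Unary.All.Properties using (tabulate⁺)
open import Data.List.Relation.Binary.Permutation.Propositional using (_↭_; ↭-reflexive)
open import Data.List.Relation.Binary.Permutation.Propositional.Properties using (↭-length)
open import Data.Nat using (ℕ; zero; suc; _+_; _*_; _∸_; _≤_; _<_; _/_; ∣_-_∣; s≤s)
open import Data.Nat.Properties
  using (+-0-commutativeMonoid; +-identityʳ; +-assoc; *-suc; *-comm; *-distribʳ-+; *-cancelˡ-≡;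
         ≤-reflexive; ≤-trans; <⇒≤; <⇒≢; <-≤-trans; m≤m+n; +-mono-≤; +-monoʳ-≤;
         m∸n+n≡m; m+n≤o⇒m≤o∸n; m≤n⇒m⊓n≡m; ∣m-m+n∣≡n; ∣m+n-m+o∣≡∣n-o∣)
open import Data.Nat.DivMod using (m*n/n≡m)
open import Data.Nat.Divisibility using (_∣_; divides)
open import Data.Product using (Σ; _×_; _,_; proj₁; proj₂)
open import Data.Sum using (inj₁; inj₂)
open import Function using (_∘_; _⇔_; mk⇔)
open import Relation.Nullary using (does; yes; no)
open import Relation.Nullary.Decidable using (does-⇔; dec-false)
open import Relation.Binary.PropositionalEquality
open ≡-Reasoning

open import Algebra.Properties.CommutativeMonoid.Sum +-0-commutativeMonoid
  using (sum-syntax; sum-cong-≗; sum-replicate-zero; ∑-distrib-+)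

𝟙 : Bool → ℕ
𝟙 b = if b then 1 else 0

incidence : ∀ {v} → Fin v → Edge v → ℕ
incidence x (u , w) = 𝟙 (does (x ≟ u)) + 𝟙 (does (x ≟ w))

span : ∀ {v} → Edge v → ℕ
span (u , w) = ∣ toℕ u - toℕ w ∣

PerfectMatchingWithLengths : ℕ → List ℕ → Set
PerfectMatchingWithLengths v L = Σ (List (Edge v)) (λ F → IsPerfectMatching v F × (ℓ v F ↭ L))

tabulate-const : ∀ {A : Set} n (x : A) → tabulate {n = n} (λ _ → x) ≡ replicate n x
tabulate-const zero    x = refl
tabulate-const (suc n) x = cong (x ∷_) (tabulate-const n x)

tabulate-toℕ : ∀ {A : Set} (f : ℕ → A) n → tabulate {n = n} (f ∘ toℕ) ≡ applyUpTo f n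
tabulate-toℕ f zero    = refl
tabulate-toℕ f (suc n) = cong (f 0 ∷_) (tabulate-toℕ (f ∘ suc) n)

length-concatMap-replicate : ∀ {A : Set} k (f : ℕ → A) xs →
  length (concatMap (λ x → replicate k (f x)) xs) ≡ length xs * k
length-concatMap-replicate k f []       = refl
length-concatMap-replicate k f (x ∷ xs) =
  trans (length-++ (replicate k (f x)))
        (cong₂ _+_ (length-replicate k) (length-concatMap-replicate k f xs))

∑-indicator : ∀ {v} (u : Fin v) c → ∑[ x < v ] (if does (x ≟ u) then c else 0) ≡ c
∑-indicator {suc v} zero    c = trans (cong (c +_) (sum-replicate-zero v)) (+-identityʳ c)
∑-indicator {suc v} (suc u) c = ∑-indicator u c

∑-one : ∀ v → ∑[ x < v ] 1 ≡ v
∑-one zero    = refl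
∑-one (suc v) = cong suc (∑-one v)

∑-incidence : ∀ {v} (e : Edge v) → ∑[ x < v ] incidence x e ≡ 2
∑-incidence (u , w) =
  trans (∑-distrib-+ (λ x → 𝟙 (does (x ≟ u))) (λ x → 𝟙 (does (x ≟ w))))
        (cong₂ _+_ (∑-indicator u 1) (∑-indicator w 1))

∑-incidences : ∀ {v} (F : List (Edge v)) → ∑[ x < v ] incidences x F ≡ 2 * length F
∑-incidences {v} []      = sum-replicate-zero v
∑-incidences {v} (e ∷ F) = begin
  ∑[ x < v ] (incidence x e + incidences x F)
    ≡⟨ ∑-distrib-+ (λ x → incidence x e) (λ x → incidences x F) ⟩
  ∑[ x < v ] incidence x e + ∑[ x < v ] incidences x F
    ≡⟨ cong₂ _+_ (∑-incidence e) (∑-incidences F) ⟩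
  2 + 2 * length F
    ≡⟨ *-suc 2 (length F) ⟨
  2 * length (e ∷ F)
    ∎

perfectMatching-size : ∀ {v} (F : List (Edge v)) → IsPerfectMatching v F → 2 * length F ≡ v
perfectMatching-size {v} F perfect = begin
  2 * length F              ≡⟨ ∑-incidences F ⟨
  ∑[ x < v ] incidences x F ≡⟨ sum-cong-≗ perfect ⟩
  ∑[ x < v ] 1              ≡⟨ ∑-one v ⟩
  v                         ∎

length-oddList : ∀ n t → length (oddList n (suc t)) ≡ n / suc t * suc t
length-oddList n t =
  trans (length-concatMap-replicate (suc t) _ (upTo (n / suc t)))
        (cong (_* suc t) (length-upTo (n / suc t)))

oddList-multiple : ∀ q t →
  oddList (q * suc t) (suc t) ≡ concatMap (λ i → replicate (suc t) (suc (2 * i))) (upTo q)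
oddList-multiple q t =
  cong (λ m → concatMap (λ i → replicate (suc t) (suc (2 * i))) (upTo m)) (m*n/n≡m q (suc t))

oddMatching⇒∣ : ∀ n t → PerfectMatchingWithLengths (2 * n) (oddList n (suc t)) → suc t ∣ n
oddMatching⇒∣ n t (F , perfect , lengths) =
  divides (n / suc t) (*-cancelˡ-≡ n (n / suc t * suc t) 2 (begin
    2 * n                           ≡⟨ perfectMatching-size F perfect ⟨
    2 * length F                    ≡⟨ cong (2 *_) (length-map (edgeLength (2 * n)) F) ⟨
    2 * length (ℓ (2 * n) F)        ≡⟨ cong (2 *_) (↭-length lengths) ⟩
    2 * length (oddList n (suc t))  ≡⟨ cong (2 *_) (length-oddList n t) ⟩
    2 * (n / suc t * suc t)         ∎))

incidences-++ : ∀ {v} (x : Fin v) F G → incidences x (F ++ G) ≡ incidences x F + incidences x G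
incidences-++ x []      G = refl
incidences-++ x (e ∷ F) G =
  trans (cong (incidence x e +_) (incidences-++ x F G)) (sym (+-assoc (incidence x e) _ _))

incidences-tabulate : ∀ {v t} (x : Fin v) (f : Fin t → Edge v) →
  incidences x (tabulate f) ≡ ∑[ j < t ] incidence x (f j)
incidences-tabulate {t = zero}  x f = refl
incidences-tabulate {t = suc t} x f = cong (incidence x (f zero) +_) (incidences-tabulate x (f ∘ suc))

-- combine j u is the vertex B·j + u, i.e. vertex u of the j-th block of B vertices.
translate : ∀ {t B} → Fin t → Edge B → Edge (t * B)
translate j (u , w) = combine j u , combine j w

edgeTranslates : ∀ {B} t → Edge B → List (Edge (t * B))
edgeTranslates t e = tabulate {n = t} (λ j → translate j e)

translates : ∀ {B} t → List (Edge B) → List (Edge (t * B))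
translates t = concatMap (edgeTranslates t)

incidence-translate : ∀ {t B} (j₀ j : Fin t) (a : Fin B) (e : Edge B) →
  incidence (combine j₀ a) (translate j e) ≡ (if does (j ≟ j₀) then incidence a e else 0)
incidence-translate j₀ j a (u , w) with j ≟ j₀
... | yes refl = cong₂ _+_ (same u) (same w)
  where
  same : ∀ b → 𝟙 (does (combine j a ≟ combine j b)) ≡ 𝟙 (does (a ≟ b))
  same b = cong 𝟙 (does-⇔ (mk⇔ (combine-injectiveʳ j a j b) (cong (combine j)))
                          (combine j a ≟ combine j b) (a ≟ b))
... | no j≢j₀ = cong₂ _+_ (elsewhere u) (elsewhere w)
  where
  elsewhere : ∀ b → 𝟙 (does (combine j₀ a ≟ combine j b)) ≡ 0
  elsewhere b =
    cong 𝟙 (dec-false (combine j₀ a ≟ combine j b) (j≢j₀ ∘ sym ∘ combine-injectiveˡ j₀ a j b))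

incidences-translates : ∀ {B} t (j₀ : Fin t) (a : Fin B) M →
  incidences (combine j₀ a) (translates t M) ≡ incidences a M
incidences-translates t j₀ a []      = refl
incidences-translates {B} t j₀ a (e ∷ M) = begin
  incidences x (edgeTranslates t e ++ translates t M)
    ≡⟨ incidences-++ x (edgeTranslates t e) (translates t M) ⟩
  incidences x (edgeTranslates t e) + incidences x (translates t M)
    ≡⟨ cong₂ _+_ copies (incidences-translates t j₀ a M) ⟩
  incidence a e + incidences a M
    ∎
  where
  x : Fin (t * B)
  x = combine j₀ a
  copies : incidences x (edgeTranslates t e) ≡ incidence a e
  copies = begin
    incidences x (edgeTranslates t e)
      ≡⟨ incidences-tabulate {t = t} x (λ j → translate j e) ⟩
    ∑[ j < t ] incidence x (translate j e)
      ≡⟨ sum-cong-≗ (λ j → incidence-translate j₀ j a e) ⟩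
    ∑[ j < t ] (if does (j ≟ j₀) then incidence a e else 0)
      ≡⟨ ∑-indicator j₀ (incidence a e) ⟩
    incidence a e
      ∎

translates-perfect : ∀ {B} t (M : List (Edge B)) →
  IsPerfectMatching B M → IsPerfectMatching (t * B) (translates t M)
translates-perfect {B} t M perfect x =
  subst (λ y → incidences y (translates t M) ≡ 1) (combine-remQuot {t} B x)
    (trans (incidences-translates t j₀ a M) (perfect a))
  where
  j₀ = proj₁ (remQuot {t} B x)
  a = proj₂ (remQuot {t} B x)

span-translate : ∀ {t B} (j : Fin t) (e : Edge B) → span (translate j e) ≡ span e
span-translate {B = B} j (u , w) rewrite toℕ-combine j u | toℕ-combine j w =
  ∣m+n-m+o∣≡∣n-o∣ (B * toℕ j) (toℕ u) (toℕ w)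

edgeLength≡span : ∀ {v} (e : Edge v) → span e + span e ≤ v → edgeLength v e ≡ span e
edgeLength≡span e short = m≤n⇒m⊓n≡m (m+n≤o⇒m≤o∸n (span e) short)

ℓ-translates : ∀ {B} t (M : List (Edge B)) → All (λ e → span e + span e ≤ t * B) M →
  ℓ (t * B) (translates t M) ≡ concatMap (λ e → replicate t (span e)) M
ℓ-translates     t []      []               = refl
ℓ-translates {B} t (e ∷ M) (short ∷ shorts) = begin
  ℓ (t * B) (edgeTranslates t e ++ translates t M)
    ≡⟨ map-++ (edgeLength (t * B)) (edgeTranslates t e) (translates t M) ⟩
  ℓ (t * B) (edgeTranslates t e) ++ ℓ (t * B) (translates t M)
    ≡⟨ cong₂ _++_ copies (ℓ-translates t M shorts) ⟩
  replicate t (span e) ++ concatMap (λ e → replicate t (span e)) M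
    ∎
  where
  translate-short : ∀ j → span (translate j e) + span (translate j e) ≤ t * B
  translate-short j = subst (λ d → d + d ≤ t * B) (sym (span-translate j e)) short
  copies : ℓ (t * B) (edgeTranslates t e) ≡ replicate t (span e)
  copies = begin
    ℓ (t * B) (edgeTranslates t e)
      ≡⟨ map-tabulate (λ j → translate j e) (edgeLength (t * B)) ⟩
    tabulate (λ j → edgeLength (t * B) (translate j e))
      ≡⟨ tabulate-cong (λ j → trans (edgeLength≡span (translate j e) (translate-short j))
                                    (span-translate j e)) ⟩
    tabulate (λ _ → span e)
      ≡⟨ tabulate-const t (span e) ⟩
    replicate t (span e)
      ∎

nestedEdge : ∀ q → Fin q → Edge (q + q)
nestedEdge q i = opposite i ↑ˡ q , q ↑ʳ i

nestedMatching : ∀ q → List (Edge (q + q))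
nestedMatching q = tabulate (nestedEdge q)

↑ˡ≢↑ʳ : ∀ {m n} (i : Fin m) (j : Fin n) → i ↑ˡ n ≢ m ↑ʳ j
↑ˡ≢↑ʳ {m} {n} i j eq = <⇒≢ toℕ-i↑ˡn<toℕ-m↑ʳj (cong toℕ eq)
  where
  toℕ-i↑ˡn<toℕ-m↑ʳj : toℕ (i ↑ˡ n) < toℕ (m ↑ʳ j)
  toℕ-i↑ˡn<toℕ-m↑ʳj = subst₂ _<_ (sym (toℕ-↑ˡ i n)) (sym (toℕ-↑ʳ m j))
                                 (<-≤-trans (toℕ<n i) (m≤m+n m (toℕ j)))

incidence-nestedEdge-↑ˡ : ∀ {q} (k i : Fin q) →
  incidence (k ↑ˡ q) (nestedEdge q i) ≡ 𝟙 (does (i ≟ opposite k))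
incidence-nestedEdge-↑ˡ {q} k i = begin
  𝟙 (does (k ↑ˡ q ≟ opposite i ↑ˡ q)) + 𝟙 (does (k ↑ˡ q ≟ q ↑ʳ i))
    ≡⟨ cong₂ _+_ (cong 𝟙 (does-⇔ mirror (k ↑ˡ q ≟ opposite i ↑ˡ q) (i ≟ opposite k)))
                 (cong 𝟙 (dec-false (k ↑ˡ q ≟ q ↑ʳ i) (↑ˡ≢↑ʳ k i))) ⟩
  𝟙 (does (i ≟ opposite k)) + 0
    ≡⟨ +-identityʳ _ ⟩
  𝟙 (does (i ≟ opposite k))
    ∎
  where
  mirror : k ↑ˡ q ≡ opposite i ↑ˡ q ⇔ i ≡ opposite k
  mirror = mk⇔
    (λ eq → trans (sym (opposite-involutive i)) (cong opposite (sym (↑ˡ-injective q k (opposite i) eq))))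
    (λ eq → cong (_↑ˡ q) (trans (sym (opposite-involutive k)) (cong opposite (sym eq))))

incidence-nestedEdge-↑ʳ : ∀ {q} (k i : Fin q) →
  incidence (q ↑ʳ k) (nestedEdge q i) ≡ 𝟙 (does (i ≟ k))
incidence-nestedEdge-↑ʳ {q} k i =
  cong₂ _+_ (cong 𝟙 (dec-false (q ↑ʳ k ≟ opposite i ↑ˡ q) (↑ˡ≢↑ʳ (opposite i) k ∘ sym)))
            (cong 𝟙 (does-⇔ (mk⇔ (sym ∘ ↑ʳ-injective q k i) (cong (q ↑ʳ_) ∘ sym))
                            (q ↑ʳ k ≟ q ↑ʳ i) (i ≟ k)))

nestedMatching-perfect : ∀ q → IsPerfectMatching (q + q) (nestedMatching q)
nestedMatching-perfect q x =
  subst (λ y → incidences y (nestedMatching q) ≡ 1) (join-splitAt q q x) (byHalf (splitAt q x))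
  where
  byHalf : ∀ s → incidences (join q q s) (nestedMatching q) ≡ 1
  byHalf (inj₁ k) = trans (incidences-tabulate (k ↑ˡ q) (nestedEdge q))
                     (trans (sum-cong-≗ (incidence-nestedEdge-↑ˡ k)) (∑-indicator (opposite k) 1))
  byHalf (inj₂ k) = trans (incidences-tabulate (q ↑ʳ k) (nestedEdge q))
                     (trans (sum-cong-≗ (incidence-nestedEdge-↑ʳ k)) (∑-indicator k 1))

span-nestedEdge : ∀ {q} (i : Fin q) → span (nestedEdge q i) ≡ suc (2 * toℕ i)
span-nestedEdge {q} i = begin
  ∣ toℕ (opposite i ↑ˡ q) - toℕ (q ↑ʳ i) ∣
    ≡⟨ cong₂ ∣_-_∣ (trans (toℕ-↑ˡ (opposite i) q) (opposite-prop i)) (toℕ-↑ʳ q i) ⟩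
  ∣ a - q + toℕ i ∣
    ≡⟨ cong (λ m → ∣ a - m + toℕ i ∣) (m∸n+n≡m (toℕ<n i)) ⟨
  ∣ a - a + suc (toℕ i) + toℕ i ∣
    ≡⟨ cong ∣ a -_∣ (+-assoc a (suc (toℕ i)) (toℕ i)) ⟩
  ∣ a - a + suc (toℕ i + toℕ i) ∣
    ≡⟨ ∣m-m+n∣≡n a (suc (toℕ i + toℕ i)) ⟩
  suc (toℕ i + toℕ i)
    ≡⟨ cong (λ m → suc (toℕ i + m)) (+-identityʳ (toℕ i)) ⟨
  suc (2 * toℕ i)
    ∎
  where
  a = q ∸ suc (toℕ i)

nestedEdge-short : ∀ {q} t (i : Fin q) →
  span (nestedEdge q i) + span (nestedEdge q i) ≤ suc (suc t) * (q + q)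
nestedEdge-short {q} t i =
  subst (λ d → d + d ≤ suc (suc t) * (q + q)) (sym (span-nestedEdge i))
    (≤-trans (+-mono-≤ half half) (+-monoʳ-≤ (q + q) (m≤m+n (q + q) (t * (q + q)))))
  where
  half : suc (2 * toℕ i) ≤ q + q
  half = +-mono-≤ (toℕ<n i) (≤-trans (≤-reflexive (+-identityʳ (toℕ i))) (<⇒≤ (toℕ<n i)))

ℓ-nestedMatching-translates : ∀ q t →
  ℓ (suc (suc t) * (q + q)) (translates (suc (suc t)) (nestedMatching q))
    ≡ oddList (q * suc (suc t)) (suc (suc t))
ℓ-nestedMatching-translates q t = begin
  ℓ (T * (q + q)) (translates T (nestedMatching q))
    ≡⟨ ℓ-translates T (nestedMatching q) (tabulate⁺ (nestedEdge-short t)) ⟩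
  concat (map (λ e → replicate T (span e)) (tabulate (nestedEdge q)))
    ≡⟨ cong concat (map-tabulate (nestedEdge q) (λ e → replicate T (span e))) ⟩
  concat (tabulate {n = q} (λ i → replicate T (span (nestedEdge q i))))
    ≡⟨ cong concat (tabulate-cong (λ i → cong (replicate T) (span-nestedEdge {q} i))) ⟩
  concat (tabulate {n = q} (λ i → replicate T (suc (2 * toℕ i))))
    ≡⟨ cong concat (tabulate-toℕ (λ i → replicate T (suc (2 * i))) q) ⟩
  concat (applyUpTo (λ i → replicate T (suc (2 * i))) q)
    ≡⟨ cong concat (map-upTo (λ i → replicate T (suc (2 * i))) q) ⟨
  concatMap (λ i → replicate T (suc (2 * i))) (upTo q)
    ≡⟨ oddList-multiple q (suc t) ⟨
  oddList (q * T) T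
    ∎
  where
  T = suc (suc t)

∣⇒oddMatching : ∀ n t →
  suc (suc t) ∣ n → PerfectMatchingWithLengths (2 * n) (oddList n (suc (suc t)))
∣⇒oddMatching _ t (divides q refl) =
  subst (λ v → PerfectMatchingWithLengths v (oddList (q * T) T)) vertices
    ( translates T (nestedMatching q)
    , translates-perfect T (nestedMatching q) (nestedMatching-perfect q)
    , ↭-reflexive (ℓ-nestedMatching-translates q t) )
  where
  T = suc (suc t)
  vertices : T * (q + q) ≡ 2 * (q * T)
  vertices = begin
    T * (q + q)         ≡⟨ *-comm T (q + q) ⟩
    (q + q) * T         ≡⟨ *-distribʳ-+ T q q ⟩
    q * T + q * T       ≡⟨ cong (q * T +_) (+-identityʳ (q * T)) ⟨
    2 * (q * T)         ∎

proposition4p4 : (n t : ℕ) → 1 ≤ n → 2 ≤ t →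
    (Σ (List (Edge (2 * n))) (λ F → IsPerfectMatching (2 * n) F × (ℓ (2 * n) F ↭ oddList n t)))
      ⇔ (t ∣ n)
proposition4p4 n (suc (suc t)) _ _ = mk⇔ (oddMatching⇒∣ n (suc t)) (∣⇒oddMatching n t)
proposition4p4 n 0 _ ()
proposition4p4 n 1 _ (s≤s ())
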